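{- Let $k_1,k_2,k_3$ be positive integers and $k=k_1+k_2+k_3$. Let $A_{3,n}(m)$ be the number of words of length $n$ over $\{1,2,3\}$ containing exactly $m$ $(k_1,k_2,k_3)$ patterns. Then $A_{3,n}(m)=[w^mz^n]\,\widetilde G_3(w,z)$, where \[ \widetilde G_3(w,z)=\frac{1-z}{(1-z)(1-3z)-(w-1)z^k}. \]
   Context: A $(k_1,k_2,k_3)$ pattern is an occurrence of a maximal run of at least $k_1$ consecutive $1$'s immediately followed by a maximal run of at least $k_2$ consecutive $2$'s immediately followed by a maximal run of at least $k_3$ consecutive $3$'s; patterns are counted by number of occurrences. $[w^mz^n]f$ denotes the coefficient of $w^mz^n$ in the power series $f$. -}

module Defs where

open import Data.Nat as ℕ using (ℕ; zero; suc; _∸_; _≤_; _≤ᵇ_)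
open import Data.Fin as Fin using (Fin)
open import Data.Bool using (Bool; true; false; if_then_else_; _∧_)
open import Data.Product using (_×_; _,_)
open import Data.List using (List; []; _∷_; map; concatMap; length; filter; upTo)
open import Data.Integer as ℤ using (ℤ; +_)
open import Relation.Nullary using (does)
open import Relation.Binary.PropositionalEquality using (_≡_)

Letter : Set
Letter = Fin 3

l1 l2 l3 : Letter
l1 = Fin.zero
l2 = Fin.suc Fin.zero
l3 = Fin.suc (Fin.suc Fin.zero)

words : ℕ → List (List Letter)
words zero    = [] ∷ []
words (suc n) = concatMap (λ w → map (λ a → a ∷ w) (l1 ∷ l2 ∷ l3 ∷ [])) (words n)

rle : List Letter → List (Letter × ℕ)
rle []       = []
rle (x ∷ xs) = push (rle xs)
  where
  push : List (Letter × ℕ) → List (Letter × ℕ)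
  push []             = (x , 1) ∷ []
  push ((y , c) ∷ rs) =
    if does (x Fin.≟ y) then (y , suc c) ∷ rs else (x , 1) ∷ (y , c) ∷ rs

is : Letter → Letter → Bool
is a b = does (a Fin.≟ b)

occRuns : ℕ → ℕ → ℕ → List (Letter × ℕ) → ℕ
occRuns k₁ k₂ k₃ ((a , p) ∷ rs@((b , q) ∷ (c , r) ∷ _)) =
  (if is a l1 ∧ is b l2 ∧ is c l3 ∧ (k₁ ≤ᵇ p) ∧ (k₂ ≤ᵇ q) ∧ (k₃ ≤ᵇ r)
     then 1 else 0) ℕ.+ occRuns k₁ k₂ k₃ rs
occRuns k₁ k₂ k₃ _ = 0

patterns : ℕ → ℕ → ℕ → List Letter → ℕ
patterns k₁ k₂ k₃ w = occRuns k₁ k₂ k₃ (rle w)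

A3 : ℕ → ℕ → ℕ → ℕ → ℕ → ℕ
A3 k₁ k₂ k₃ n m = length (filter (λ w → patterns k₁ k₂ k₃ w ℕ.≟ m) (words n))

-- Formal power series in two variables w, z with integer coefficients:
-- f m n is the coefficient [w^m z^n] f.

PS : Set
PS = ℕ → ℕ → ℤ

sumℤ : List ℤ → ℤ
sumℤ []       = + 0
sumℤ (x ∷ xs) = x ℤ.+ sumℤ xs

infixl 6 _⊕_ _⊖_
infixl 7 _⊛_

_⊕_ : PS → PS → PS
(f ⊕ g) m n = f m n ℤ.+ g m n

_⊖_ : PS → PS → PS
(f ⊖ g) m n = f m n ℤ.- g m n

_⊛_ : PS → PS → PS
(f ⊛ g) m n =
  sumℤ (map (λ i → sumℤ (map (λ j → f i j ℤ.* g (m ∸ i) (n ∸ j)) (upTo (suc n))))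
            (upTo (suc m)))

const : ℤ → PS
const c zero zero = c
const c _    _    = + 0

𝟙 : PS
𝟙 = const (+ 1)

Z : PS
Z zero (suc zero) = + 1
Z _    _          = + 0

W : PS
W (suc zero) zero = + 1
W _          _    = + 0

_^^_ : PS → ℕ → PS
f ^^ zero  = 𝟙
f ^^ suc k = f ⊛ (f ^^ k)

numG : PS
numG = 𝟙 ⊖ Z

denG : ℕ → PS
denG k = (𝟙 ⊖ Z) ⊛ (𝟙 ⊖ const (+ 3) ⊛ Z) ⊖ (W ⊖ 𝟙) ⊛ (Z ^^ k)

Aseries : ℕ → ℕ → ℕ → PS
Aseries k₁ k₂ k₃ m n = + A3 k₁ k₂ k₃ n m

module Submission where

-- Let A = Σ A_{3,n}(m) wᵐ zⁿ, and let T count, with the same weight wᵐ zⁿ, the words of length n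
-- that begin with exactly k₁ 1's followed by at least k₂ 2's and at least k₃ 3's, m being the
-- number of patterns after these three runs.  Prepending a letter to a word changes its number of
-- patterns only when the letter is 1 and completes such a beginning, so A (1 − 3z) + (1 − w) T = 1.
-- Shortening the run of 2's by one when it is longer than k₂, and otherwise deleting the prefix
-- 1^k₁ 2^k₂ 3^k₃, gives (1 − z) T = zᵏ A.  Eliminating T leaves A ((1 − z)(1 − 3z) − (w − 1) zᵏ) =
-- 1 − z, checked coefficientwise after writing the Cauchy product with the denominator as a
-- combination of shifts of A.

open import Defs
open import Data.Bool using (Bool; true; false; if_then_else_; _∧_; not)
open import Data.Bool.Properties using (∧-zeroʳ; ∧-identityʳ; ∧-comm)
import Data.Fin as Fin
open import Data.Fin.Properties using (_≟_)
open import Data.List using (List; []; _∷_; _++_; map; concatMap; length; filter; applyUpTo; upTo)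
open import Data.Nat using (ℕ; zero; suc)
open import Data.Product using (_×_; _,_)
open import Function using (_∘_)
open import Relation.Nullary using (Dec; does; yes; no; ¬_)
open import Relation.Nullary.Decidable using (dec-true; dec-false)
open import Relation.Binary.PropositionalEquality

module Words where
  open import Data.Bool using (T)
  open import Data.Nat using (_+_; _≤ᵇ_; _≡ᵇ_)
  open import Data.Nat.Properties using (+-assoc; +-identityʳ; +-suc)
  open import Data.Nat.Tactic.RingSolver using (solve-∀)

  pattern one   = Fin.zero
  pattern two   = Fin.suc Fin.zero
  pattern three = Fin.suc (Fin.suc Fin.zero)

  Word : Set
  Word = List Letter

  Runs : Set
  Runs = List (Letter × ℕ)

  -- The local helper of Defs.rle, which cannot be referred to from outside.
  push : Letter → Runs → Runs
  push a []             = (a , 1) ∷ []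
  push a ((b , c) ∷ rs) = if is a b then (b , suc c) ∷ rs else (a , 1) ∷ (b , c) ∷ rs

  rle-∷ : ∀ a w → rle (a ∷ w) ≡ push a (rle w)
  rle-∷ a w with rle w
  ... | []    = refl
  ... | _ ∷ _ = refl

  is-refl : ∀ a → is a a ≡ true
  is-refl a = dec-true (a ≟ a) refl

  leading : Letter → Word → ℕ
  leading a []      = 0
  leading a (b ∷ w) = if is b a then suc (leading a w) else 0

  dropLeading : Letter → Word → Word
  dropLeading a []      = []
  dropLeading a (b ∷ w) = if is b a then dropLeading a w else b ∷ w

  headRun : Letter → Runs → ℕ
  headRun a []            = 0
  headRun a ((b , c) ∷ _) = if is b a then c else 0

  dropHeadRun : Letter → Runs → Runs
  dropHeadRun a []             = []
  dropHeadRun a ((b , c) ∷ rs) = if is b a then rs else (b , c) ∷ rs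

  headRun-push : ∀ a b rs → headRun a (push b rs) ≡ (if is b a then suc (headRun a rs) else 0)
  headRun-push a b [] = refl
  headRun-push a b ((c , n) ∷ rs) with b ≟ c
  ... | yes refl with is b a
  ...   | true  = refl
  ...   | false = refl
  headRun-push a b ((c , n) ∷ rs) | no b≢c with b ≟ a
  ...   | yes refl rewrite dec-false (c ≟ b) (λ c≡b → b≢c (sym c≡b)) = refl
  ...   | no _     = refl

  dropHeadRun-push : ∀ a b rs →
    dropHeadRun a (push b rs) ≡ (if is b a then dropHeadRun a rs else push b rs)
  dropHeadRun-push a b [] with is b a
  ... | true  = refl
  ... | false = refl
  dropHeadRun-push a b ((c , n) ∷ rs) with b ≟ c
  ... | yes refl with is b a
  ...   | true  = refl
  ...   | false = refl
  dropHeadRun-push a b ((c , n) ∷ rs) | no b≢c with b ≟ a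
  ...   | yes refl rewrite dec-false (c ≟ b) (λ c≡b → b≢c (sym c≡b)) = refl
  ...   | no _     = refl

  headRun-rle : ∀ a w → headRun a (rle w) ≡ leading a w
  headRun-rle a []      = refl
  headRun-rle a (b ∷ w) = begin
    headRun a (rle (b ∷ w))
      ≡⟨ cong (headRun a) (rle-∷ b w) ⟩
    headRun a (push b (rle w))
      ≡⟨ headRun-push a b (rle w) ⟩
    (if is b a then suc (headRun a (rle w)) else 0)
      ≡⟨ cong (λ n → if is b a then suc n else 0) (headRun-rle a w) ⟩
    leading a (b ∷ w) ∎
    where open ≡-Reasoning

  dropHeadRun-rle : ∀ a w → dropHeadRun a (rle w) ≡ rle (dropLeading a w)
  dropHeadRun-rle a []      = refl
  dropHeadRun-rle a (b ∷ w) rewrite rle-∷ b w | dropHeadRun-push a b (rle w) with is b a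
  ... | true  = dropHeadRun-rle a w
  ... | false = sym (rle-∷ b w)

  exactRun : Letter → ℕ → (Word → Bool) → Word → Bool
  exactRun a c P w = (leading a w ≡ᵇ c) ∧ P (dropLeading a w)

  longRun : Letter → ℕ → (Word → Bool) → Word → Bool
  longRun a c P w = (c ≤ᵇ leading a w) ∧ P (dropLeading a w)

  exactRunᴿ : Letter → ℕ → (Runs → Bool) → Runs → Bool
  exactRunᴿ a c P rs = (headRun a rs ≡ᵇ c) ∧ P (dropHeadRun a rs)

  longRunᴿ : Letter → ℕ → (Runs → Bool) → Runs → Bool
  longRunᴿ a c P rs = (c ≤ᵇ headRun a rs) ∧ P (dropHeadRun a rs)

  exactRun-rle : ∀ a c P w → exactRunᴿ a c P (rle w) ≡ exactRun a c (λ v → P (rle v)) w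
  exactRun-rle a c P w rewrite headRun-rle a w | dropHeadRun-rle a w = refl

  longRun-rle : ∀ a c P w → longRunᴿ a c P (rle w) ≡ longRun a c (λ v → P (rle v)) w
  longRun-rle a c P w rewrite headRun-rle a w | dropHeadRun-rle a w = refl

  exactRun-cong : ∀ a c {P Q} w → (∀ v → P v ≡ Q v) → exactRun a c P w ≡ exactRun a c Q w
  exactRun-cong a c w e = cong (_ ∧_) (e _)

  longRun-cong : ∀ a c {P Q} w → (∀ v → P v ≡ Q v) → longRun a c P w ≡ longRun a c Q w
  longRun-cong a c w e = cong (_ ∧_) (e _)

  ∧∧-false : ∀ x y → x ∧ y ∧ false ≡ false
  ∧∧-false x y rewrite ∧-zeroʳ y = ∧-zeroʳ x

  ∧-guard : ∀ b x y y′ → (T b → y′ ≡ y) → (b ∧ x) ∧ y ≡ b ∧ x ∧ y′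
  ∧-guard true  x y y′ e = cong (x ∧_) (sym (e _))
  ∧-guard false x y y′ e = refl

  exactRun-∧ : ∀ a c (P Q : Word → Bool) w →
    (T (leading a w ≡ᵇ c) → Q (dropLeading a w) ≡ Q w) →
    exactRun a c P w ∧ Q w ≡ exactRun a c (λ v → P v ∧ Q v) w
  exactRun-∧ a c P Q w = ∧-guard _ (P (dropLeading a w)) (Q w) (Q (dropLeading a w))

  longRun-∧ : ∀ a c (P Q : Word → Bool) w → Q (dropLeading a w) ≡ Q w →
    longRun a c P w ∧ Q w ≡ longRun a c (λ v → P v ∧ Q v) w
  longRun-∧ a c P Q w e = ∧-guard _ (P (dropLeading a w)) (Q w) (Q (dropLeading a w)) λ _ → e

  exactRun-zero : ∀ a (P : Word → Bool) w →
    (∀ v → P (a ∷ v) ≡ false) → exactRun a 0 P w ≡ P w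
  exactRun-zero a P []      none = refl
  exactRun-zero a P (b ∷ w) none with b ≟ a
  ... | yes refl = sym (none w)
  ... | no _     = refl

  fromBool : Bool → ℕ
  fromBool b = if b then 1 else 0

  count : (Word → Bool) → List Word → ℕ
  count P []       = 0
  count P (w ∷ ws) = fromBool (P w) + count P ws

  length-filter : ∀ {P : Word → Set} (P? : ∀ w → Dec (P w)) ws →
    length (filter P? ws) ≡ count (λ w → does (P? w)) ws
  length-filter P? []       = refl
  length-filter P? (w ∷ ws) with does (P? w)
  ... | true  = cong suc (length-filter P? ws)
  ... | false = length-filter P? ws

  count-cong : ∀ {P Q} ws → (∀ w → P w ≡ Q w) → count P ws ≡ count Q ws
  count-cong []       e = refl
  count-cong (w ∷ ws) e = cong₂ _+_ (cong fromBool (e w)) (count-cong ws e)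

  count-false : ∀ {P} ws → (∀ w → P w ≡ false) → count P ws ≡ 0
  count-false []       e = refl
  count-false (w ∷ ws) e rewrite e w = count-false ws e

  count-++ : ∀ (P : Word → Bool) ws vs → count P (ws ++ vs) ≡ count P ws + count P vs
  count-++ P []       vs = refl
  count-++ P (w ∷ ws) vs rewrite count-++ P ws vs = sym (+-assoc (fromBool (P w)) _ _)

  count-split : ∀ (P B : Word → Bool) ws →
    count P ws ≡ count (λ w → P w ∧ B w) ws + count (λ w → P w ∧ not (B w)) ws
  count-split P B []       = refl
  count-split P B (w ∷ ws) rewrite count-split P B ws with P w | B w
  ... | false | _     = refl
  ... | true  | true  = refl
  ... | true  | false = sym (+-suc _ _)

  #words : (Word → Bool) → ℕ → ℕ
  #words P n = count P (words n)

  #words-cong : ∀ {P Q} n → (∀ w → P w ≡ Q w) → #words P n ≡ #words Q n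
  #words-cong n = count-cong (words n)

  #words-suc : ∀ (P : Word → Bool) n → #words P (suc n) ≡
    #words (λ w → P (l1 ∷ w)) n + #words (λ w → P (l2 ∷ w)) n + #words (λ w → P (l3 ∷ w)) n
  #words-suc P n = go (words n)
    where
    prepend : Word → List Word
    prepend w = map (_∷ w) (l1 ∷ l2 ∷ l3 ∷ [])
    rearrange : ∀ a b c x y z → a + (b + (c + 0)) + (x + y + z) ≡ a + x + (b + y) + (c + z)
    rearrange = solve-∀
    go : ∀ ws → count P (concatMap prepend ws) ≡
         count (λ w → P (l1 ∷ w)) ws + count (λ w → P (l2 ∷ w)) ws + count (λ w → P (l3 ∷ w)) ws
    go []       = refl
    go (w ∷ ws) = trans (count-++ P (prepend w) (concatMap prepend ws))
      (trans (cong (count P (prepend w) +_) (go ws))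
        (rearrange (fromBool (P (l1 ∷ w))) (fromBool (P (l2 ∷ w))) (fromBool (P (l3 ∷ w)))
                   _ _ _))

  #words-∷-only : ∀ a (P : Word → Bool) n → (∀ b w → b ≢ a → P (b ∷ w) ≡ false) →
    #words P (suc n) ≡ #words (λ w → P (a ∷ w)) n
  #words-∷-only a P n only = trans (#words-suc P n) (cases a only)
    where
    none : ∀ b → (∀ w → P (b ∷ w) ≡ false) → #words (λ w → P (b ∷ w)) n ≡ 0
    none b = count-false (words n)
    cases : ∀ a → (∀ b w → b ≢ a → P (b ∷ w) ≡ false) →
      #words (λ w → P (l1 ∷ w)) n + #words (λ w → P (l2 ∷ w)) n + #words (λ w → P (l3 ∷ w)) n ≡
      #words (λ w → P (a ∷ w)) n
    cases one only
      rewrite none l2 (λ w → only l2 w λ ()) | none l3 (λ w → only l3 w λ ()) =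
      trans (+-identityʳ _) (+-identityʳ _)
    cases two only
      rewrite none l1 (λ w → only l1 w λ ()) | none l3 (λ w → only l3 w λ ()) = +-identityʳ _
    cases three only
      rewrite none l1 (λ w → only l1 w λ ()) | none l2 (λ w → only l2 w λ ()) = refl

  delay : ℕ → (ℕ → ℕ) → ℕ → ℕ
  delay zero    f n       = f n
  delay (suc c) f zero    = 0
  delay (suc c) f (suc n) = delay c f n

  delay-cong : ∀ {f g} → (∀ n → f n ≡ g n) → ∀ c n → delay c f n ≡ delay c g n
  delay-cong e zero    n       = e n
  delay-cong e (suc c) zero    = refl
  delay-cong e (suc c) (suc n) = delay-cong e c n

  delay-+ : ∀ c d f n → delay c (delay d f) n ≡ delay (c + d) f n
  delay-+ zero    d f n       = refl
  delay-+ (suc c) d f zero    = refl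
  delay-+ (suc c) d f (suc n) = delay-+ c d f n

  delay-step : ∀ {f g} → (∀ n → f (suc n) ≡ f n + g (suc n)) → f 0 ≡ g 0 →
    ∀ c n → delay c f (suc n) ≡ delay c f n + delay c g (suc n)
  delay-step step base zero          n       = step n
  delay-step step base (suc zero)    zero    = base
  delay-step step base (suc (suc c)) zero    = refl
  delay-step step base (suc c)       (suc n) = delay-step step base c n

  #words-delay : ∀ a (F : ℕ → Word → Bool) →
    (∀ c w → F (suc c) (a ∷ w) ≡ F c w) →
    (∀ c b w → b ≢ a → F (suc c) (b ∷ w) ≡ false) →
    (∀ c → F (suc c) [] ≡ false) →
    ∀ c n → #words (F c) n ≡ delay c (#words (F 0)) n
  #words-delay a F self other empty zero    n       = refl
  #words-delay a F self other empty (suc c) zero    rewrite empty c = refl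
  #words-delay a F self other empty (suc c) (suc n) =
    trans (#words-∷-only a (F (suc c)) n (other c))
      (trans (#words-cong n (self c)) (#words-delay a F self other empty c n))

  ≤ᵇ-suc : ∀ c n → (suc c ≤ᵇ suc n) ≡ (c ≤ᵇ n)
  ≤ᵇ-suc zero    n = refl
  ≤ᵇ-suc (suc c) n = refl

  #words-exactRun : ∀ a c P n → #words (exactRun a c P) n ≡ delay c (#words (exactRun a 0 P)) n
  #words-exactRun a c P = #words-delay a (λ c → exactRun a c P) self other (λ _ → refl) c
    where
    self : ∀ c w → exactRun a (suc c) P (a ∷ w) ≡ exactRun a c P w
    self c w rewrite is-refl a = refl
    other : ∀ c b w → b ≢ a → exactRun a (suc c) P (b ∷ w) ≡ false
    other c b w b≢a rewrite dec-false (b ≟ a) b≢a = refl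

  #words-longRun : ∀ a c P n → #words (longRun a c P) n ≡ delay c (#words (longRun a 0 P)) n
  #words-longRun a c P = #words-delay a (λ c → longRun a c P) self other (λ _ → refl) c
    where
    self : ∀ c w → longRun a (suc c) P (a ∷ w) ≡ longRun a c P w
    self c w rewrite is-refl a = cong (_∧ _) (≤ᵇ-suc c (leading a w))
    other : ∀ c b w → b ≢ a → longRun a (suc c) P (b ∷ w) ≡ false
    other c b w b≢a rewrite dec-false (b ≟ a) b≢a = refl

  #words-longRun-zero : ∀ a P n → (∀ w → P (a ∷ w) ≡ false) →
    #words (longRun a 0 P) (suc n) ≡ #words (longRun a 0 P) n + #words P (suc n)
  #words-longRun-zero a P n none
    rewrite #words-suc (longRun a 0 P) n | #words-suc P n = cases a none
    where
    #P : Letter → ℕ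
    #P b = #words (λ w → P (b ∷ w)) n
    shuffle₂ : ∀ x l z → x + l + z ≡ l + (x + 0 + z)
    shuffle₂ = solve-∀
    shuffle₃ : ∀ x y l → x + y + l ≡ l + (x + y + 0)
    shuffle₃ = solve-∀
    cases : ∀ a → (∀ w → P (a ∷ w) ≡ false) →
      #words (λ w → longRun a 0 P (one ∷ w)) n + #words (λ w → longRun a 0 P (two ∷ w)) n +
      #words (λ w → longRun a 0 P (three ∷ w)) n ≡
      #words (longRun a 0 P) n + (#P one + #P two + #P three)
    cases one none rewrite count-false (words n) none = +-assoc (#words (longRun one 0 P) n) _ _
    cases two none rewrite count-false (words n) none =
      shuffle₂ (#P one) (#words (longRun two 0 P) n) (#P three)
    cases three none rewrite count-false (words n) none =
      shuffle₃ (#P one) (#P two) (#words (longRun three 0 P) n)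

module Series where
  open Words using (delay; ≤ᵇ-suc)
  open import Data.List.Properties using (map-upTo)
  import Data.Nat as ℕ
  open import Data.Nat using (_∸_; _≤ᵇ_; _≡ᵇ_; _<_; _≤_; s≤s; z≤n)
  import Data.Nat.Properties as ℕ
  open import Data.Integer using (ℤ; +_; _+_; _-_; _*_; -_)
  import Data.Integer.Properties as ℤ
  open import Data.Integer.Tactic.RingSolver using (solve-∀)

  ∑< : ℕ → (ℕ → ℤ) → ℤ
  ∑< N f = sumℤ (applyUpTo f N)

  syntax ∑< N (λ i → e) = ∑[ i < N ] e

  ∑-cong : ∀ N {f g : ℕ → ℤ} → (∀ i → f i ≡ g i) → ∑< N f ≡ ∑< N g
  ∑-cong zero    e = refl
  ∑-cong (suc N) e = cong₂ _+_ (e 0) (∑-cong N (e ∘ suc))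

  ∑-zero : ∀ N (f : ℕ → ℤ) → (∀ i → i < N → f i ≡ + 0) → ∑< N f ≡ + 0
  ∑-zero zero    f z = refl
  ∑-zero (suc N) f z rewrite z 0 (s≤s z≤n) =
    trans (ℤ.+-identityˡ _) (∑-zero N (f ∘ suc) λ i i<N → z (suc i) (s≤s i<N))

  ∑-single : ∀ N (f : ℕ → ℤ) p → p < N →
    (∀ i → i < N → i ≢ p → f i ≡ + 0) → ∑< N f ≡ f p
  ∑-single (suc N) f zero    _         z =
    trans (cong (λ x → f 0 + x) (∑-zero N (f ∘ suc) λ i i<N → z (suc i) (s≤s i<N) λ ()))
      (ℤ.+-identityʳ (f 0))
  ∑-single (suc N) f (suc p) (s≤s p<N) z rewrite z 0 (s≤s z≤n) (λ ()) =
    trans (ℤ.+-identityˡ _)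
      (∑-single N (f ∘ suc) p p<N λ i i<N i≢p → z (suc i) (s≤s i<N) (i≢p ∘ ℕ.suc-injective))

  ∑-+ : ∀ N (f g : ℕ → ℤ) → ∑[ i < N ] (f i + g i) ≡ ∑< N f + ∑< N g
  ∑-+ zero    f g = refl
  ∑-+ (suc N) f g rewrite ∑-+ N (f ∘ suc) (g ∘ suc) = interchange (f 0) (g 0) _ _
    where
    interchange : ∀ a b c d → (a + b) + (c + d) ≡ (a + c) + (b + d)
    interchange = solve-∀

  ∑-neg : ∀ N (f : ℕ → ℤ) → ∑[ i < N ] (- f i) ≡ - ∑< N f
  ∑-neg zero    f = refl
  ∑-neg (suc N) f rewrite ∑-neg N (f ∘ suc) = sym (ℤ.neg-distrib-+ (f 0) _)

  ∑-difference : ∀ N (f g : ℕ → ℤ) → ∑[ i < N ] (f i - g i) ≡ ∑< N f - ∑< N g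
  ∑-difference N f g = trans (∑-+ N f (-_ ∘ g)) (cong (λ x → ∑< N f + x) (∑-neg N g))

  ≡ᵇ-true : ∀ {m n} → m ≡ n → (m ≡ᵇ n) ≡ true
  ≡ᵇ-true {m} {n} = dec-true (m ℕ.≟ n)

  ≡ᵇ-false : ∀ {m n} → m ≢ n → (m ≡ᵇ n) ≡ false
  ≡ᵇ-false {m} {n} = dec-false (m ℕ.≟ n)

  ≤ᵇ-true : ∀ {m n} → m ≤ n → (m ≤ᵇ n) ≡ true
  ≤ᵇ-true {m} {n} = dec-true (m ℕ.≤? n)

  ≤ᵇ-false : ∀ {m n} → ¬ m ≤ n → (m ≤ᵇ n) ≡ false
  ≤ᵇ-false {m} {n} = dec-false (m ℕ.≤? n)

  ∑-δ∸ : ∀ N b (g : ℕ → ℤ) →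
    ∑[ i < suc N ] (if N ∸ i ≡ᵇ b then g i else + 0) ≡ (if b ≤ᵇ N then g (N ∸ b) else + 0)
  ∑-δ∸ N b g with b ℕ.≤? N
  ... | yes b≤N rewrite ≤ᵇ-true b≤N = begin
    ∑[ i < suc N ] (if N ∸ i ≡ᵇ b then g i else + 0)
      ≡⟨ ∑-single (suc N) _ (N ∸ b) (s≤s (ℕ.m∸n≤m N b)) off ⟩
    (if N ∸ (N ∸ b) ≡ᵇ b then g (N ∸ b) else + 0)
      ≡⟨ cong (λ x → if x ≡ᵇ b then g (N ∸ b) else + 0) (ℕ.m∸[m∸n]≡n b≤N) ⟩
    (if b ≡ᵇ b then g (N ∸ b) else + 0)
      ≡⟨ cong (λ x → if x then g (N ∸ b) else + 0) (≡ᵇ-true {b} refl) ⟩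
    g (N ∸ b) ∎
    where
    open ≡-Reasoning
    off : ∀ i → i < suc N → i ≢ N ∸ b → (if N ∸ i ≡ᵇ b then g i else + 0) ≡ + 0
    off i (s≤s i≤N) i≢ = cong (λ x → if x then g i else + 0)
      (≡ᵇ-false {N ∸ i} {b} λ e → i≢ (trans (sym (ℕ.m∸[m∸n]≡n i≤N)) (cong (N ∸_) e)))
  ... | no b≰N rewrite ≤ᵇ-false b≰N = ∑-zero (suc N) _ λ i _ →
    cong (λ x → if x then g i else + 0) (≡ᵇ-false λ e → b≰N (subst (_≤ N) e (ℕ.m∸n≤m N i)))

  ∑-if : ∀ N B (f : ℕ → ℤ) →
    ∑[ i < N ] (if B then f i else + 0) ≡ (if B then ∑< N f else + 0)
  ∑-if N true  f = refl
  ∑-if N false f = ∑-zero N _ λ _ _ → refl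

  ⊛-∑ : ∀ f g m n →
    (f ⊛ g) m n ≡ ∑[ i < suc m ] ∑[ j < suc n ] (f i j * g (m ∸ i) (n ∸ j))
  ⊛-∑ f g m n =
    trans (cong sumℤ (map-upTo (λ i → sumℤ (map (term i) (upTo (suc n)))) (suc m)))
    (∑-cong (suc m) λ i → cong sumℤ (map-upTo (term i) (suc n)))
    where
    term : ℕ → ℕ → ℤ
    term i j = f i j * g (m ∸ i) (n ∸ j)

  infix 4 _≈_
  _≈_ : PS → PS → Set
  f ≈ g = ∀ m n → f m n ≡ g m n

  ⊛-congʳ : ∀ f {g h} → g ≈ h → f ⊛ g ≈ f ⊛ h
  ⊛-congʳ f {g} {h} g≈h m n = begin
    (f ⊛ g) m n
      ≡⟨ ⊛-∑ f g m n ⟩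
    ∑[ i < suc m ] ∑[ j < suc n ] (f i j * g (m ∸ i) (n ∸ j))
      ≡⟨ ∑-cong (suc m) (λ i → ∑-cong (suc n) λ j → cong (f i j *_) (g≈h (m ∸ i) (n ∸ j))) ⟩
    ∑[ i < suc m ] ∑[ j < suc n ] (f i j * h (m ∸ i) (n ∸ j))
      ≡⟨ ⊛-∑ f h m n ⟨
    (f ⊛ h) m n ∎
    where open ≡-Reasoning

  ⊛-distribˡ : ∀ (_∙_ : ℤ → ℤ → ℤ) →
    (∀ a x y → a * (x ∙ y) ≡ (a * x) ∙ (a * y)) →
    (∀ N f g → ∑[ i < N ] (f i ∙ g i) ≡ (∑< N f) ∙ (∑< N g)) →
    ∀ f g h m n → (f ⊛ (λ m n → g m n ∙ h m n)) m n ≡ ((f ⊛ g) m n) ∙ ((f ⊛ h) m n)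
  ⊛-distribˡ _∙_ *-distrib ∑-distrib f g h m n = begin
    (f ⊛ (λ m n → g m n ∙ h m n)) m n
      ≡⟨ ⊛-∑ f (λ m n → g m n ∙ h m n) m n ⟩
    ∑[ i < suc m ] ∑[ j < suc n ] (f i j * (g (m ∸ i) (n ∸ j) ∙ h (m ∸ i) (n ∸ j)))
      ≡⟨ ∑-cong (suc m) (λ i →
           trans (∑-cong (suc n) λ j → *-distrib (f i j) (g (m ∸ i) (n ∸ j)) (h (m ∸ i) (n ∸ j)))
                 (∑-distrib (suc n) (fg i) (fh i))) ⟩
    ∑[ i < suc m ] ((∑< (suc n) (fg i)) ∙ (∑< (suc n) (fh i)))
      ≡⟨ ∑-distrib (suc m) (∑< (suc n) ∘ fg) (∑< (suc n) ∘ fh) ⟩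
    (∑[ i < suc m ] ∑< (suc n) (fg i)) ∙ (∑[ i < suc m ] ∑< (suc n) (fh i))
      ≡⟨ cong₂ _∙_ (⊛-∑ f g m n) (⊛-∑ f h m n) ⟨
    ((f ⊛ g) m n) ∙ ((f ⊛ h) m n) ∎
    where
    open ≡-Reasoning
    fg fh : ℕ → ℕ → ℤ
    fg i j = f i j * g (m ∸ i) (n ∸ j)
    fh i j = f i j * h (m ∸ i) (n ∸ j)

  ⊛-distribˡ-⊕ : ∀ f g h → f ⊛ (g ⊕ h) ≈ f ⊛ g ⊕ f ⊛ h
  ⊛-distribˡ-⊕ = ⊛-distribˡ _+_ ℤ.*-distribˡ-+ ∑-+

  ⊛-distribˡ-⊖ : ∀ f g h → f ⊛ (g ⊖ h) ≈ f ⊛ g ⊖ f ⊛ h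
  ⊛-distribˡ-⊖ = ⊛-distribˡ _-_ *-distribˡ-difference ∑-difference
    where
    *-distribˡ-difference : ∀ a b c → a * (b - c) ≡ a * b - a * c
    *-distribˡ-difference = solve-∀

  monomial : ℤ → ℕ → ℕ → PS
  monomial c a b m n = if (m ≡ᵇ a) ∧ (n ≡ᵇ b) then c else + 0

  -- multiplication by wᵃ zᵇ
  shift : ℕ → ℕ → PS → PS
  shift a b f m n = if (a ≤ᵇ m) ∧ (b ≤ᵇ n) then f (m ∸ a) (n ∸ b) else + 0

  ⊛-monomial : ∀ f c a b m n → (f ⊛ monomial c a b) m n ≡ shift a b f m n * c
  ⊛-monomial f c a b m n = begin
    (f ⊛ monomial c a b) m n
      ≡⟨ ⊛-∑ f (monomial c a b) m n ⟩
    ∑[ i < suc m ] ∑[ j < suc n ] (f i j * monomial c a b (m ∸ i) (n ∸ j))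
      ≡⟨ ∑-cong (suc m) (λ i → ∑-cong (suc n) λ j → *-monomial (f i j) (m ∸ i) (n ∸ j)) ⟩
    ∑[ i < suc m ] ∑[ j < suc n ]
      (if m ∸ i ≡ᵇ a then (if n ∸ j ≡ᵇ b then f i j * c else + 0) else + 0)
      ≡⟨ ∑-cong (suc m) (λ i → ∑-if (suc n) (m ∸ i ≡ᵇ a) (inner i)) ⟩
    ∑[ i < suc m ] (if m ∸ i ≡ᵇ a then ∑< (suc n) (inner i) else + 0)
      ≡⟨ ∑-cong (suc m) (λ i →
           cong (λ x → if m ∸ i ≡ᵇ a then x else + 0) (∑-δ∸ n b λ j → f i j * c)) ⟩
    ∑[ i < suc m ] (if m ∸ i ≡ᵇ a then (if b ≤ᵇ n then f i (n ∸ b) * c else + 0) else + 0)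
      ≡⟨ ∑-δ∸ m a (λ i → if b ≤ᵇ n then f i (n ∸ b) * c else + 0) ⟩
    (if a ≤ᵇ m then (if b ≤ᵇ n then f (m ∸ a) (n ∸ b) * c else + 0) else + 0)
      ≡⟨ if-∧-* (a ≤ᵇ m) (b ≤ᵇ n) ⟩
    shift a b f m n * c ∎
    where
    open ≡-Reasoning
    inner : ℕ → ℕ → ℤ
    inner i j = if n ∸ j ≡ᵇ b then f i j * c else + 0
    *-monomial : ∀ x u v → x * monomial c a b u v ≡
      (if u ≡ᵇ a then (if v ≡ᵇ b then x * c else + 0) else + 0)
    *-monomial x u v with u ≡ᵇ a | v ≡ᵇ b
    ... | true  | true  = refl
    ... | true  | false = ℤ.*-zeroʳ x
    ... | false | _     = ℤ.*-zeroʳ x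
    if-∧-* : ∀ A B → (if A then (if B then f (m ∸ a) (n ∸ b) * c else + 0) else + 0) ≡
      (if A ∧ B then f (m ∸ a) (n ∸ b) else + 0) * c
    if-∧-* true  true  = refl
    if-∧-* true  false = refl
    if-∧-* false B     = refl

  shift-cong : ∀ a b {f g} → f ≈ g → shift a b f ≈ shift a b g
  shift-cong a b f≈g m n =
    cong (λ x → if (a ≤ᵇ m) ∧ (b ≤ᵇ n) then x else + 0) (f≈g (m ∸ a) (n ∸ b))

  shift-⊖ : ∀ a b f g → shift a b (f ⊖ g) ≈ shift a b f ⊖ shift a b g
  shift-⊖ a b f g m n with (a ≤ᵇ m) ∧ (b ≤ᵇ n)
  ... | true  = refl
  ... | false = refl

  ∸≡ᵇ : ∀ a a′ m → (a ≤ᵇ m) ∧ (m ∸ a ≡ᵇ a′) ≡ (m ≡ᵇ a ℕ.+ a′)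
  ∸≡ᵇ zero    a′ m       = refl
  ∸≡ᵇ (suc a) a′ zero    = refl
  ∸≡ᵇ (suc a) a′ (suc m) rewrite ≤ᵇ-suc a m = ∸≡ᵇ a a′ m

  shift-monomial : ∀ a b c a′ b′ →
    shift a b (monomial c a′ b′) ≈ monomial c (a′ ℕ.+ a) (b′ ℕ.+ b)
  shift-monomial a b c a′ b′ m n rewrite ℕ.+-comm a′ a | ℕ.+-comm b′ b =
    trans (if-∧-if (a ≤ᵇ m) (b ≤ᵇ n) (m ∸ a ≡ᵇ a′) (n ∸ b ≡ᵇ b′))
      (cong₂ (λ x y → if x ∧ y then c else + 0) (∸≡ᵇ a a′ m) (∸≡ᵇ b b′ n))
    where
    if-∧-if : ∀ A B C D → (if A ∧ B then (if C ∧ D then c else + 0) else + 0) ≡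
      (if (A ∧ C) ∧ (B ∧ D) then c else + 0)
    if-∧-if false B     C     D = refl
    if-∧-if true  false false D = refl
    if-∧-if true  false true  D = refl
    if-∧-if true  true  C     D = refl

  const≈monomial : ∀ c → const c ≈ monomial c 0 0
  const≈monomial c zero    zero    = refl
  const≈monomial c zero    (suc n) = refl
  const≈monomial c (suc m) n       = refl

  Z≈monomial : Z ≈ monomial (+ 1) 0 1
  Z≈monomial zero    zero          = refl
  Z≈monomial zero    (suc zero)    = refl
  Z≈monomial zero    (suc (suc n)) = refl
  Z≈monomial (suc m) n             = refl

  W≈monomial : W ≈ monomial (+ 1) 1 0
  W≈monomial zero          n       = refl
  W≈monomial (suc zero)    zero    = refl
  W≈monomial (suc zero)    (suc n) = refl
  W≈monomial (suc (suc m)) n       = refl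

  Z^^≈monomial : ∀ k → Z ^^ k ≈ monomial (+ 1) 0 k
  Z^^≈monomial zero    = const≈monomial (+ 1)
  Z^^≈monomial (suc k) m n = begin
    (Z ⊛ Z ^^ k) m n                     ≡⟨ ⊛-congʳ Z (Z^^≈monomial k) m n ⟩
    (Z ⊛ monomial (+ 1) 0 k) m n         ≡⟨ ⊛-monomial Z (+ 1) 0 k m n ⟩
    shift 0 k Z m n * + 1                ≡⟨ ℤ.*-identityʳ _ ⟩
    shift 0 k Z m n                      ≡⟨ shift-cong 0 k Z≈monomial m n ⟩
    shift 0 k (monomial (+ 1) 0 1) m n   ≡⟨ shift-monomial 0 k (+ 1) 0 1 m n ⟩
    monomial (+ 1) 0 (suc k) m n         ∎
    where open ≡-Reasoning

  denominator : ℕ → PS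
  denominator k = monomial (+ 1) 0 0 ⊖ monomial (+ 4) 0 1 ⊕ monomial (+ 3) 0 2
                ⊖ (monomial (+ 1) 1 k ⊖ monomial (+ 1) 0 k)

  denG≈denominator : ∀ k → denG k ≈ denominator k
  denG≈denominator k m n = cong₂ _-_ (quadratic m n) (wTerm m n)
    where
    open ≡-Reasoning
    linear : 𝟙 ⊖ const (+ 3) ⊛ Z ≈ monomial (+ 1) 0 0 ⊖ monomial (+ 3) 0 1
    linear m n = cong₂ _-_ (const≈monomial (+ 1) m n) (begin
      (const (+ 3) ⊛ Z) m n                    ≡⟨ ⊛-congʳ (const (+ 3)) Z≈monomial m n ⟩
      (const (+ 3) ⊛ monomial (+ 1) 0 1) m n   ≡⟨ ⊛-monomial (const (+ 3)) (+ 1) 0 1 m n ⟩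
      shift 0 1 (const (+ 3)) m n * + 1        ≡⟨ ℤ.*-identityʳ _ ⟩
      shift 0 1 (const (+ 3)) m n              ≡⟨ shift-cong 0 1 (const≈monomial (+ 3)) m n ⟩
      shift 0 1 (monomial (+ 3) 0 0) m n       ≡⟨ shift-monomial 0 1 (+ 3) 0 0 m n ⟩
      monomial (+ 3) 0 1 m n                   ∎)

    expand : ∀ m n → shift 0 0 (𝟙 ⊖ Z) m n * + 1 - shift 0 1 (𝟙 ⊖ Z) m n * + 3 ≡
      (monomial (+ 1) 0 0 ⊖ monomial (+ 4) 0 1 ⊕ monomial (+ 3) 0 2) m n
    expand zero    zero                = refl
    expand zero    (suc zero)          = refl
    expand zero    (suc (suc zero))    = refl
    expand zero    (suc (suc (suc n))) = refl
    expand (suc m) zero                = refl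
    expand (suc m) (suc n)             = refl

    quadratic : (𝟙 ⊖ Z) ⊛ (𝟙 ⊖ const (+ 3) ⊛ Z) ≈
      monomial (+ 1) 0 0 ⊖ monomial (+ 4) 0 1 ⊕ monomial (+ 3) 0 2
    quadratic m n = begin
      ((𝟙 ⊖ Z) ⊛ (𝟙 ⊖ const (+ 3) ⊛ Z)) m n
        ≡⟨ ⊛-congʳ (𝟙 ⊖ Z) linear m n ⟩
      ((𝟙 ⊖ Z) ⊛ (monomial (+ 1) 0 0 ⊖ monomial (+ 3) 0 1)) m n
        ≡⟨ ⊛-distribˡ-⊖ (𝟙 ⊖ Z) (monomial (+ 1) 0 0) (monomial (+ 3) 0 1) m n ⟩
      ((𝟙 ⊖ Z) ⊛ monomial (+ 1) 0 0) m n - ((𝟙 ⊖ Z) ⊛ monomial (+ 3) 0 1) m n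
        ≡⟨ cong₂ _-_ (⊛-monomial (𝟙 ⊖ Z) (+ 1) 0 0 m n)
                     (⊛-monomial (𝟙 ⊖ Z) (+ 3) 0 1 m n) ⟩
      shift 0 0 (𝟙 ⊖ Z) m n * + 1 - shift 0 1 (𝟙 ⊖ Z) m n * + 3
        ≡⟨ expand m n ⟩
      (monomial (+ 1) 0 0 ⊖ monomial (+ 4) 0 1 ⊕ monomial (+ 3) 0 2) m n ∎

    wTerm : (W ⊖ 𝟙) ⊛ Z ^^ k ≈ monomial (+ 1) 1 k ⊖ monomial (+ 1) 0 k
    wTerm m n = begin
      ((W ⊖ 𝟙) ⊛ Z ^^ k) m n
        ≡⟨ ⊛-congʳ (W ⊖ 𝟙) (Z^^≈monomial k) m n ⟩
      ((W ⊖ 𝟙) ⊛ monomial (+ 1) 0 k) m n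
        ≡⟨ ⊛-monomial (W ⊖ 𝟙) (+ 1) 0 k m n ⟩
      shift 0 k (W ⊖ 𝟙) m n * + 1
        ≡⟨ ℤ.*-identityʳ _ ⟩
      shift 0 k (W ⊖ 𝟙) m n
        ≡⟨ shift-cong 0 k (λ m n → cong₂ _-_ (W≈monomial m n) (const≈monomial (+ 1) m n))
                      m n ⟩
      shift 0 k (monomial (+ 1) 1 0 ⊖ monomial (+ 1) 0 0) m n
        ≡⟨ shift-⊖ 0 k (monomial (+ 1) 1 0) (monomial (+ 1) 0 0) m n ⟩
      shift 0 k (monomial (+ 1) 1 0) m n - shift 0 k (monomial (+ 1) 0 0) m n
        ≡⟨ cong₂ _-_ (shift-monomial 0 k (+ 1) 1 0 m n) (shift-monomial 0 k (+ 1) 0 0 m n) ⟩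
      monomial (+ 1) 1 k m n - monomial (+ 1) 0 k m n ∎

  timesDenominator : ℕ → PS → PS
  timesDenominator k f m n = f m n * + 1 - shift 0 1 f m n * + 4 + shift 0 2 f m n * + 3
                             - (shift 1 k f m n * + 1 - shift 0 k f m n * + 1)

  ⊛-denominator : ∀ f k → f ⊛ denominator k ≈ timesDenominator k f
  ⊛-denominator f k m n = begin
    (f ⊛ denominator k) m n
      ≡⟨ distribute ⟩
    (f ⊛ m₀₀) m n - (f ⊛ m₀₁) m n + (f ⊛ m₀₂) m n - ((f ⊛ m₁ₖ) m n - (f ⊛ m₀ₖ) m n)
      ≡⟨ cong₂ _-_ (cong₂ _+_ (cong₂ _-_ (⊛-monomial f (+ 1) 0 0 m n) (⊛-monomial f (+ 4) 0 1 m n))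
                              (⊛-monomial f (+ 3) 0 2 m n))
                   (cong₂ _-_ (⊛-monomial f (+ 1) 1 k m n) (⊛-monomial f (+ 1) 0 k m n)) ⟩
    timesDenominator k f m n ∎
    where
    open ≡-Reasoning
    m₀₀ m₀₁ m₀₂ m₁ₖ m₀ₖ : PS
    m₀₀ = monomial (+ 1) 0 0
    m₀₁ = monomial (+ 4) 0 1
    m₀₂ = monomial (+ 3) 0 2
    m₁ₖ = monomial (+ 1) 1 k
    m₀ₖ = monomial (+ 1) 0 k
    distribute : (f ⊛ denominator k) m n ≡
      (f ⊛ m₀₀) m n - (f ⊛ m₀₁) m n + (f ⊛ m₀₂) m n - ((f ⊛ m₁ₖ) m n - (f ⊛ m₀ₖ) m n)
    distribute = trans (⊛-distribˡ-⊖ f (m₀₀ ⊖ m₀₁ ⊕ m₀₂) (m₁ₖ ⊖ m₀ₖ) m n)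
      (cong₂ _-_ (trans (⊛-distribˡ-⊕ f (m₀₀ ⊖ m₀₁) m₀₂ m n)
                        (cong (λ x → x + (f ⊛ m₀₂) m n) (⊛-distribˡ-⊖ f m₀₀ m₀₁ m n)))
                 (⊛-distribˡ-⊖ f m₁ₖ m₀ₖ m n))

  shift-delay : ∀ b (f : ℕ → ℕ → ℕ) m n →
    shift 0 b (λ m n → + f m n) m n ≡ + delay b (f m) n
  shift-delay zero    f m n       = refl
  shift-delay (suc b) f m zero    = refl
  shift-delay (suc b) f m (suc n) rewrite ≤ᵇ-suc b n = shift-delay b f m n

  eliminateT : ∀ α β γ τ τz τw τwz {κ κw e ez : ℤ} →
    α - + 3 * β + (τ - τw) ≡ e → β - + 3 * γ + (τz - τwz) ≡ ez →
    τ - τz ≡ κ → τw - τwz ≡ κw →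
    α * + 1 - β * + 4 + γ * + 3 - (κw * + 1 - κ * + 1) ≡ e - ez
  eliminateT α β γ τ τz τw τwz refl refl refl refl = identity α β γ τ τz τw τwz
    where
    identity : ∀ α β γ τ τz τw τwz →
      α * + 1 - β * + 4 + γ * + 3 - ((τw - τwz) * + 1 - (τ - τz) * + 1) ≡
      α - + 3 * β + (τ - τw) - (β - + 3 * γ + (τz - τwz))
    identity = solve-∀

-- The parameters are k₁ − 1, k₂ − 1, k₃ − 1, so that the kᵢ are positive by definition.
module Patterns (i₁ i₂ i₃ : ℕ) where
  open Words
  import Data.Nat as ℕ
  open import Data.Nat using (_+_; _*_; _≤ᵇ_; _≡ᵇ_; _≤_)
  open import Data.Nat.Properties
    using (+-comm; +-identityʳ; +-commutativeSemigroup; <⇒≤; <⇒≢; ≤-reflexive; ≡ᵇ⇒≡)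
  open import Algebra.Properties.CommutativeSemigroup +-commutativeSemigroup using (xy∙z≈xz∙y)
  open import Data.Nat.Tactic.RingSolver using (solve-∀)

  k₁ k₂ k₃ : ℕ
  k₁ = suc i₁
  k₂ = suc i₂
  k₃ = suc i₃

  occ : Runs → ℕ
  occ = occRuns k₁ k₂ k₃

  patternTailᴿ : Runs → Bool
  patternTailᴿ = longRunᴿ l2 k₂ (longRunᴿ l3 k₃ λ _ → true)

  completesPatternᴿ : Runs → Bool
  completesPatternᴿ = exactRunᴿ l1 i₁ patternTailᴿ

  patternTailᴿ-single : ∀ b q → patternTailᴿ ((b , q) ∷ []) ≡ false
  patternTailᴿ-single one   q = refl
  patternTailᴿ-single two   q = ∧-zeroʳ (k₂ ≤ᵇ q)
  patternTailᴿ-single three q = refl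

  firstTriple-condition : ∀ p b q c r rs →
    is b l2 ∧ is c l3 ∧ (k₁ ≤ᵇ p) ∧ (k₂ ≤ᵇ q) ∧ (k₃ ≤ᵇ r) ≡
    (k₁ ≤ᵇ p) ∧ patternTailᴿ ((b , q) ∷ (c , r) ∷ rs)
  firstTriple-condition p two q three r rs =
    cong (λ x → (k₁ ≤ᵇ p) ∧ (k₂ ≤ᵇ q) ∧ x) (sym (∧-identityʳ _))
  firstTriple-condition p two q one   r rs = sym (∧∧-false (k₁ ≤ᵇ p) (k₂ ≤ᵇ q))
  firstTriple-condition p two q two   r rs = sym (∧∧-false (k₁ ≤ᵇ p) (k₂ ≤ᵇ q))
  firstTriple-condition p one   q c r rs = sym (∧-zeroʳ _)
  firstTriple-condition p three q c r rs = sym (∧-zeroʳ _)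

  noPattern : ∀ a p rs → patternTailᴿ rs ≡ false →
    fromBool (is a l1 ∧ (k₁ ≤ᵇ p) ∧ patternTailᴿ rs) ≡ 0
  noPattern a p rs none rewrite none = cong fromBool (∧∧-false (is a l1) (k₁ ≤ᵇ p))

  occ-∷ : ∀ a p rs →
    occ ((a , p) ∷ rs) ≡ fromBool (is a l1 ∧ (k₁ ≤ᵇ p) ∧ patternTailᴿ rs) + occ rs
  occ-∷ a p []                       = sym (cong (_+ 0) (noPattern a p [] refl))
  occ-∷ a p ((b , q) ∷ [])           =
    sym (cong (_+ 0) (noPattern a p ((b , q) ∷ []) (patternTailᴿ-single b q)))
  occ-∷ a p ((b , q) ∷ (c , r) ∷ rs) =
    cong (λ x → fromBool (is a l1 ∧ x) + occ ((b , q) ∷ (c , r) ∷ rs))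
         (firstTriple-condition p b q c r rs)

  fromBool-≤ᵇ-suc : ∀ i c b → fromBool ((suc i ≤ᵇ suc c) ∧ b) ≡
    fromBool ((suc i ≤ᵇ c) ∧ b) + fromBool ((c ≡ᵇ i) ∧ b)
  fromBool-≤ᵇ-suc zero    zero    b = refl
  fromBool-≤ᵇ-suc zero    (suc c) b = sym (+-identityʳ _)
  fromBool-≤ᵇ-suc (suc i) zero    b = refl
  fromBool-≤ᵇ-suc (suc i) (suc c) b = fromBool-≤ᵇ-suc i c b

  ≤ᵇ1≡≡ᵇ1 : ∀ i → (suc i ≤ᵇ 1) ≡ (1 ≡ᵇ suc i)
  ≤ᵇ1≡≡ᵇ1 zero    = refl
  ≤ᵇ1≡≡ᵇ1 (suc i) = refl

  occ-∷-≢ : ∀ a p rs → a ≢ l1 → occ ((a , p) ∷ rs) ≡ occ rs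
  occ-∷-≢ a p rs a≢1 = trans (occ-∷ a p rs)
    (cong (λ x → fromBool (x ∧ (k₁ ≤ᵇ p) ∧ patternTailᴿ rs) + occ rs) (dec-false (a ≟ l1) a≢1))

  occ-push-≢ : ∀ a rs → a ≢ l1 → occ (push a rs) ≡ occ rs
  occ-push-≢ a []             a≢1 = refl
  occ-push-≢ a ((b , c) ∷ rs) a≢1 with a ≟ b
  ... | yes refl = trans (occ-∷-≢ a (suc c) rs a≢1) (sym (occ-∷-≢ a c rs a≢1))
  ... | no _     = occ-∷-≢ a 1 ((b , c) ∷ rs) a≢1

  occ-fresh₁ : ∀ rs →
    occ ((l1 , 1) ∷ rs) ≡ occ rs + fromBool ((0 ≡ᵇ i₁) ∧ patternTailᴿ rs)
  occ-fresh₁ rs = trans (occ-∷ l1 1 rs)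
    (trans (cong (λ x → fromBool (x ∧ patternTailᴿ rs) + occ rs) (≤ᵇ1≡≡ᵇ1 i₁))
           (+-comm _ (occ rs)))

  occ-push : ∀ a rs → occ (push a rs) ≡ occ rs + fromBool (is a l1 ∧ completesPatternᴿ rs)
  occ-push a []  = sym (cong fromBool (∧∧-false (is a l1) (0 ≡ᵇ i₁)))
  occ-push one ((one , c) ∷ rs) = begin
    occ ((one , suc c) ∷ rs)
      ≡⟨ occ-∷ one (suc c) rs ⟩
    fromBool ((k₁ ≤ᵇ suc c) ∧ patternTailᴿ rs) + occ rs
      ≡⟨ cong (_+ occ rs) (fromBool-≤ᵇ-suc i₁ c (patternTailᴿ rs)) ⟩
    fromBool ((k₁ ≤ᵇ c) ∧ patternTailᴿ rs) + fromBool ((c ≡ᵇ i₁) ∧ patternTailᴿ rs) + occ rs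
      ≡⟨ xy∙z≈xz∙y (fromBool ((k₁ ≤ᵇ c) ∧ patternTailᴿ rs)) new (occ rs) ⟩
    fromBool ((k₁ ≤ᵇ c) ∧ patternTailᴿ rs) + occ rs + fromBool ((c ≡ᵇ i₁) ∧ patternTailᴿ rs)
      ≡⟨ cong (_+ new) (sym (occ-∷ one c rs)) ⟩
    occ ((one , c) ∷ rs) + fromBool ((c ≡ᵇ i₁) ∧ patternTailᴿ rs) ∎
    where
    open ≡-Reasoning
    new = fromBool ((c ≡ᵇ i₁) ∧ patternTailᴿ rs)
  occ-push one   ((two   , c) ∷ rs) = occ-fresh₁ ((two , c) ∷ rs)
  occ-push one   ((three , c) ∷ rs) = occ-fresh₁ ((three , c) ∷ rs)
  occ-push two   rs = trans (occ-push-≢ two rs λ ()) (sym (+-identityʳ _))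
  occ-push three rs = trans (occ-push-≢ three rs λ ()) (sym (+-identityʳ _))

  pat : Word → ℕ
  pat = patterns k₁ k₂ k₃

  patternTail : Word → Bool
  patternTail = longRun l2 k₂ (longRun l3 k₃ λ _ → true)

  completesPattern : Word → Bool
  completesPattern = exactRun l1 i₁ patternTail

  completesPattern-rle : ∀ w → completesPatternᴿ (rle w) ≡ completesPattern w
  completesPattern-rle w =
    trans (exactRun-rle l1 i₁ patternTailᴿ w) (exactRun-cong l1 i₁ w patternTail-rle)
    where
    patternTail-rle : ∀ v → patternTailᴿ (rle v) ≡ patternTail v
    patternTail-rle v = trans (longRun-rle l2 k₂ (longRunᴿ l3 k₃ λ _ → true) v)
      (longRun-cong l2 k₂ v (longRun-rle l3 k₃ λ _ → true))

  patterns-∷ : ∀ a w → pat (a ∷ w) ≡ pat w + fromBool (is a l1 ∧ completesPattern w)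
  patterns-∷ a w = begin
    occ (rle (a ∷ w))
      ≡⟨ cong occ (rle-∷ a w) ⟩
    occ (push a (rle w))
      ≡⟨ occ-push a (rle w) ⟩
    pat w + fromBool (is a l1 ∧ completesPatternᴿ (rle w))
      ≡⟨ cong (λ x → pat w + fromBool (is a l1 ∧ x)) (completesPattern-rle w) ⟩
    pat w + fromBool (is a l1 ∧ completesPattern w) ∎
    where open ≡-Reasoning

  patterns-∷-≢ : ∀ a w → a ≢ l1 → pat (a ∷ w) ≡ pat w
  patterns-∷-≢ a w a≢1 = trans (patterns-∷ a w)
    (trans (cong (λ x → pat w + fromBool (x ∧ completesPattern w)) (dec-false (a ≟ l1) a≢1))
      (+-identityʳ (pat w)))

  patterns-dropLeading : ∀ a w → a ≢ l1 → pat (dropLeading a w) ≡ pat w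
  patterns-dropLeading a []      a≢1 = refl
  patterns-dropLeading a (b ∷ w) a≢1 with b ≟ a
  ... | yes refl = trans (patterns-dropLeading b w a≢1) (sym (patterns-∷-≢ b w a≢1))
  ... | no _     = refl

  patterns-dropLeading₁ : ∀ w → leading l1 w ≤ i₁ → pat (dropLeading l1 w) ≡ pat w
  patterns-dropLeading₁ []          _ = refl
  patterns-dropLeading₁ (one ∷ w)   short = begin
    pat (dropLeading l1 w)
      ≡⟨ patterns-dropLeading₁ w (<⇒≤ short) ⟩
    pat w
      ≡⟨ +-identityʳ (pat w) ⟨
    pat w + fromBool false
      ≡⟨ cong (λ x → pat w + fromBool (x ∧ patternTail (dropLeading l1 w))) tooShort ⟨
    pat w + fromBool (completesPattern w)
      ≡⟨ patterns-∷ l1 w ⟨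
    pat (l1 ∷ w) ∎
    where
    open ≡-Reasoning
    tooShort : (leading l1 w ≡ᵇ i₁) ≡ false
    tooShort = dec-false (leading l1 w ℕ.≟ i₁) (<⇒≢ short)
  patterns-dropLeading₁ (two ∷ w)   _ = refl
  patterns-dropLeading₁ (three ∷ w) _ = refl

  hasPatterns : ℕ → Word → Bool
  hasPatterns m w = pat w ≡ᵇ m

  A3-#words : ∀ n m → A3 k₁ k₂ k₃ n m ≡ #words (hasPatterns m) n
  A3-#words n m = length-filter (λ w → pat w ℕ.≟ m) (words n)

  hasPatterns-dropLeading : ∀ m a v → a ≢ l1 → hasPatterns m (dropLeading a v) ≡ hasPatterns m v
  hasPatterns-dropLeading m a v a≢1 = cong (_≡ᵇ m) (patterns-dropLeading a v a≢1)

  afterPattern : ℕ → Word → Bool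
  afterPattern m = longRun l2 k₂ (longRun l3 k₃ (hasPatterns m))

  completesPattern-∧ : ∀ m w →
    completesPattern w ∧ hasPatterns m w ≡ exactRun l1 i₁ (afterPattern m) w
  completesPattern-∧ m w =
    trans (exactRun-∧ l1 i₁ patternTail Q w λ exact →
             cong (_≡ᵇ m) (patterns-dropLeading₁ w (≤-reflexive (≡ᵇ⇒≡ _ _ exact))))
      (exactRun-cong l1 i₁ w λ v →
        trans (longRun-∧ l2 k₂ (longRun l3 k₃ λ _ → true) Q v (hasPatterns-dropLeading m l2 v λ ()))
          (longRun-cong l2 k₂ v λ u →
            longRun-∧ l3 k₃ (λ _ → true) Q u (hasPatterns-dropLeading m l3 u λ ())))
    where
    Q : Word → Bool
    Q = hasPatterns m

  hasPatterns-∷₁ : ∀ m v → hasPatterns m (l1 ∷ v) ≡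
    (if completesPattern v then suc (pat v) ≡ᵇ m else hasPatterns m v)
  hasPatterns-∷₁ m v rewrite patterns-∷ l1 v with completesPattern v
  ... | true  = cong (_≡ᵇ m) (+-comm (pat v) 1)
  ... | false = cong (_≡ᵇ m) (+-identityʳ (pat v))

  prepend-count : ∀ m n →
    #words (hasPatterns m) (suc n) + #words (λ v → completesPattern v ∧ hasPatterns m v) n ≡
    3 * #words (hasPatterns m) n + #words (λ v → completesPattern v ∧ (suc (pat v) ≡ᵇ m)) n
  prepend-count m n = begin
    #words Q (suc n) + S
      ≡⟨ cong (_+ S) (#words-suc Q n) ⟩
    #words (λ v → Q (l1 ∷ v)) n + #words (λ v → Q (l2 ∷ v)) n + #words (λ v → Q (l3 ∷ v)) n + S
      ≡⟨ cong₂ (λ x y → x + y + #words (λ v → Q (l3 ∷ v)) n + S)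
               prepend₁ (prepend≢₁ l2 λ ()) ⟩
    new + B + #words Q n + #words (λ v → Q (l3 ∷ v)) n + S
      ≡⟨ cong (λ x → new + B + #words Q n + x + S) (prepend≢₁ l3 λ ()) ⟩
    new + B + #words Q n + #words Q n + S
      ≡⟨ cong (λ x → new + B + x + x + S) split ⟩
    new + B + (S + B) + (S + B) + S
      ≡⟨ rearrange new B S ⟩
    3 * (S + B) + new
      ≡⟨ cong (λ x → 3 * x + new) split ⟨
    3 * #words Q n + new ∎
    where
    open ≡-Reasoning
    Q C : Word → Bool
    Q = hasPatterns m
    C = completesPattern
    S B new : ℕ
    S   = #words (λ v → C v ∧ Q v) n
    B   = #words (λ v → Q v ∧ not (C v)) n
    new = #words (λ v → C v ∧ (suc (pat v) ≡ᵇ m)) n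

    split : #words Q n ≡ S + B
    split = trans (count-split Q C (words n))
                  (cong (_+ B) (#words-cong n λ v → ∧-comm (Q v) (C v)))

    prepend₁ : #words (λ v → Q (l1 ∷ v)) n ≡ new + B
    prepend₁ = trans (count-split (λ v → Q (l1 ∷ v)) C (words n))
      (cong₂ _+_ (#words-cong n created) (#words-cong n notCreated))
      where
      created : ∀ v → Q (l1 ∷ v) ∧ C v ≡ C v ∧ (suc (pat v) ≡ᵇ m)
      created v rewrite hasPatterns-∷₁ m v with C v
      ... | true  = ∧-identityʳ _
      ... | false = ∧-zeroʳ _
      notCreated : ∀ v → Q (l1 ∷ v) ∧ not (C v) ≡ Q v ∧ not (C v)
      notCreated v rewrite hasPatterns-∷₁ m v with C v
      ... | true  = trans (∧-zeroʳ _) (sym (∧-zeroʳ _))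
      ... | false = refl

    prepend≢₁ : ∀ a → a ≢ l1 → #words (λ v → Q (a ∷ v)) n ≡ #words Q n
    prepend≢₁ a a≢1 = #words-cong n λ v → cong (_≡ᵇ m) (patterns-∷-≢ a v a≢1)

    rearrange : ∀ new B S → new + B + (S + B) + (S + B) + S ≡ 3 * (S + B) + new
    rearrange = solve-∀

  K : ℕ
  K = k₁ + k₂ + k₃

  startsPattern : ℕ → Word → Bool
  startsPattern m = exactRun l1 k₁ (afterPattern m)

  #startsPattern-suc : ∀ m n →
    #words (startsPattern m) (suc n) ≡ #words (λ v → completesPattern v ∧ hasPatterns m v) n
  #startsPattern-suc m n = begin
    #words (exactRun l1 k₁ (afterPattern m)) (suc n)
      ≡⟨ #words-exactRun l1 k₁ (afterPattern m) (suc n) ⟩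
    delay i₁ (#words (exactRun l1 0 (afterPattern m))) n
      ≡⟨ #words-exactRun l1 i₁ (afterPattern m) n ⟨
    #words (exactRun l1 i₁ (afterPattern m)) n
      ≡⟨ #words-cong n (completesPattern-∧ m) ⟨
    #words (λ v → completesPattern v ∧ hasPatterns m v) n ∎
    where open ≡-Reasoning

  #startsPattern-step : ∀ m n →
    #words (startsPattern m) (suc n) ≡
    #words (startsPattern m) n + delay K (#words (hasPatterns m)) (suc n)
  #startsPattern-step m n = begin
    #words (startsPattern m) (suc n)
      ≡⟨ as-delay (suc n) ⟩
    delay (k₁ + k₂) #twos (suc n)
      ≡⟨ delay-step twos-step refl (k₁ + k₂) n ⟩
    delay (k₁ + k₂) #twos n + delay (k₁ + k₂) (delay k₃ #Q) (suc n)
      ≡⟨ cong₂ _+_ (sym (as-delay n)) (delay-+ (k₁ + k₂) k₃ #Q (suc n)) ⟩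
    #words (startsPattern m) n + delay K #Q (suc n) ∎
    where
    open ≡-Reasoning
    Q : Word → Bool
    Q = hasPatterns m
    #Q #twos : ℕ → ℕ
    #Q = #words Q
    #twos = #words (longRun l2 0 (longRun l3 k₃ Q))

    #threes : ∀ n → #words (longRun l3 k₃ Q) n ≡ delay k₃ #Q n
    #threes n = trans (#words-longRun l3 k₃ Q n)
      (delay-cong (λ n → #words-cong n λ w → hasPatterns-dropLeading m l3 w λ ()) k₃ n)

    twos-step : ∀ n → #twos (suc n) ≡ #twos n + delay k₃ #Q (suc n)
    twos-step n = trans (#words-longRun-zero l2 (longRun l3 k₃ Q) n λ _ → refl)
      (cong (#twos n +_) (#threes (suc n)))

    as-delay : ∀ n → #words (startsPattern m) n ≡ delay (k₁ + k₂) #twos n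
    as-delay n = begin
      #words (exactRun l1 k₁ (afterPattern m)) n
        ≡⟨ #words-exactRun l1 k₁ (afterPattern m) n ⟩
      delay k₁ (#words (exactRun l1 0 (afterPattern m))) n
        ≡⟨ delay-cong (λ n → #words-cong n λ w → exactRun-zero l1 (afterPattern m) w λ _ → refl)
                      k₁ n ⟩
      delay k₁ (#words (afterPattern m)) n
        ≡⟨ delay-cong (#words-longRun l2 k₂ (longRun l3 k₃ Q)) k₁ n ⟩
      delay k₁ (delay k₂ #twos) n
        ≡⟨ delay-+ k₁ k₂ #twos n ⟩
      delay (k₁ + k₂) #twos n ∎

  recurrence : ∀ m n → A3 k₁ k₂ k₃ (suc n) m + #words (startsPattern m) (suc n) ≡
    3 * A3 k₁ k₂ k₃ n m + #words (λ v → completesPattern v ∧ (suc (pat v) ≡ᵇ m)) n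
  recurrence m n rewrite A3-#words (suc n) m | A3-#words n m | #startsPattern-suc m n =
    prepend-count m n

  recurrence-zero : ∀ n →
    A3 k₁ k₂ k₃ (suc n) 0 + #words (startsPattern 0) (suc n) ≡ 3 * A3 k₁ k₂ k₃ n 0 + 0
  recurrence-zero n = trans (recurrence 0 n)
    (cong (3 * A3 k₁ k₂ k₃ n 0 +_) (count-false (words n) λ v → ∧-zeroʳ (completesPattern v)))

  recurrence-suc : ∀ m n →
    A3 k₁ k₂ k₃ (suc n) (suc m) + #words (startsPattern (suc m)) (suc n) ≡
    3 * A3 k₁ k₂ k₃ n (suc m) + #words (startsPattern m) (suc n)
  recurrence-suc m n = trans (recurrence (suc m) n)
    (cong (3 * A3 k₁ k₂ k₃ n (suc m) +_) (sym (#startsPattern-suc m n)))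

module Coefficients (i₁ i₂ i₃ : ℕ) where
  open Words
  open Series
  open Patterns i₁ i₂ i₃
  import Data.Nat as ℕ
  open import Data.Integer using (ℤ; +_; _+_; _-_; _*_)
  import Data.Integer.Properties as ℤ
  open import Data.Integer.Tactic.RingSolver using (solve-∀)

  A T : PS
  A = Aseries k₁ k₂ k₃
  T m n = + #words (startsPattern m) n

  lift-prepend : ∀ x z {y w} →
    x ℕ.+ y ≡ 3 ℕ.* z ℕ.+ w → + x - + 3 * + z + (+ y - + w) ≡ + 0
  lift-prepend x z {y} {w} e = begin
    + x - + 3 * + z + (+ y - + w)
      ≡⟨ rearrange (+ x) (+ y) (+ z) (+ w) ⟩
    (+ x + + y) - (+ 3 * + z + + w)
      ≡⟨ cong₂ _-_ (ℤ.pos-+ x y) (cong (_+ + w) (ℤ.pos-* 3 z)) ⟨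
    + (x ℕ.+ y) - (+ (3 ℕ.* z) + + w)
      ≡⟨ cong₂ _-_ (cong +_ e) (ℤ.pos-+ (3 ℕ.* z) w) ⟩
    + (3 ℕ.* z ℕ.+ w) - + (3 ℕ.* z ℕ.+ w)
      ≡⟨ ℤ.+-inverseʳ (+ (3 ℕ.* z ℕ.+ w)) ⟩
    + 0 ∎
    where
    open ≡-Reasoning
    rearrange : ∀ x y z w → x - + 3 * z + (y - w) ≡ (x + y) - (+ 3 * z + w)
    rearrange = solve-∀

  lift-step : ∀ x y z → x ≡ y ℕ.+ z → + x - + y ≡ + z
  lift-step x y z e = begin
    + x - + y              ≡⟨ cong (λ v → + v - + y) e ⟩
    + (y ℕ.+ z) - + y      ≡⟨ cong (_- + y) (ℤ.pos-+ y z) ⟩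
    + y + + z - + y        ≡⟨ cancel (+ y) (+ z) ⟩
    + z ∎
    where
    open ≡-Reasoning
    cancel : ∀ y z → y + z - y ≡ z
    cancel = solve-∀

  prepend-identity : ∀ m n →
    A m n - + 3 * shift 0 1 A m n + (T m n - shift 1 0 T m n) ≡ 𝟙 m n
  prepend-identity zero    zero    = refl
  prepend-identity (suc m) zero    = refl
  prepend-identity zero    (suc n) =
    lift-prepend (A3 k₁ k₂ k₃ (suc n) 0) (A3 k₁ k₂ k₃ n 0) (recurrence-zero n)
  prepend-identity (suc m) (suc n) =
    lift-prepend (A3 k₁ k₂ k₃ (suc n) (suc m)) (A3 k₁ k₂ k₃ n (suc m)) (recurrence-suc m n)

  prepend-identity-z : ∀ m n →
    shift 0 1 A m n - + 3 * shift 0 2 A m n + (shift 0 1 T m n - shift 1 1 T m n) ≡ Z m n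
  prepend-identity-z zero    zero          = refl
  prepend-identity-z (suc m) zero          = refl
  prepend-identity-z zero    (suc zero)    = prepend-identity zero zero
  prepend-identity-z zero    (suc (suc n)) = prepend-identity zero (suc n)
  prepend-identity-z (suc m) (suc n)       = prepend-identity (suc m) n

  startsPattern-identity : ∀ m n → T m n - shift 0 1 T m n ≡ shift 0 K A m n
  startsPattern-identity m zero    = refl
  startsPattern-identity m (suc n) = trans (lift-step _ _ _ (#startsPattern-step m n))
    (sym (trans (shift-delay K (λ m n → A3 k₁ k₂ k₃ n m) m (suc n))
                (cong +_ (delay-cong (λ n → A3-#words n m) K (suc n)))))

  startsPattern-identity-w : ∀ m n → shift 1 0 T m n - shift 1 1 T m n ≡ shift 1 K A m n
  startsPattern-identity-w zero    n = refl
  startsPattern-identity-w (suc m) n = startsPattern-identity m n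

  timesDenominator-A : timesDenominator K A ≈ numG
  timesDenominator-A m n =
    eliminateT (A m n) (shift 0 1 A m n) (shift 0 2 A m n)
               (T m n) (shift 0 1 T m n) (shift 1 0 T m n) (shift 1 1 T m n)
               (prepend-identity m n) (prepend-identity-z m n)
               (startsPattern-identity m n) (startsPattern-identity-w m n)

open Series using (⊛-congʳ; denominator; denG≈denominator; timesDenominator; ⊛-denominator)
open import Data.Nat using (_≤_; _+_; s≤s; z≤n)

proposition4 : (k₁ k₂ k₃ : ℕ) → 1 ≤ k₁ → 1 ≤ k₂ → 1 ≤ k₃ →
    ∀ m n → (Aseries k₁ k₂ k₃ ⊛ denG (k₁ + k₂ + k₃)) m n ≡ numG m n
proposition4 (suc i₁) (suc i₂) (suc i₃) (s≤s z≤n) (s≤s z≤n) (s≤s z≤n) m n = begin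
  (A ⊛ denG K) m n           ≡⟨ ⊛-congʳ A (denG≈denominator K) m n ⟩
  (A ⊛ denominator K) m n    ≡⟨ ⊛-denominator A K m n ⟩
  timesDenominator K A m n   ≡⟨ timesDenominator-A m n ⟩
  numG m n                   ∎
  where
  open ≡-Reasoning
  open Patterns i₁ i₂ i₃ using (K)
  open Coefficients i₁ i₂ i₃ using (A; timesDenominator-A)
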